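{- Let $n\ge1$ and $k\ge1$ be integers. Let $\mathcal O\subseteq[n]$ be a set with $k+1$ elements and $1\in\mathcal O$. For every $i\in[k]$ there exists a bijection $\varphi_i$ of $\mathcal P_n^{k+1}(\mathcal O)$ onto itself such that for all $\pi\in\mathcal P_n^{k+1}(\mathcal O)$, $$\mathrm{stat}_i(\pi)=\mathrm{stat}_{i+1}(\varphi_i(\pi))-1.$$
   Context: $\mathcal P_n^{k+1}$ denotes the set of set partitions of $[n]$ into $k+1$ blocks, written $\pi=B_1-\cdots-B_{k+1}$ with the blocks listed in increasing order of their smallest elements. Let $w_a$ be the index of the block containing $a$. The openers $\mathcal O(\pi)$ are the smallest elements of the blocks, and the closers $\mathcal F(\pi)$ are their largest elements. $\mathcal P_n^{k+1}(\mathcal O)$ is the set of $\pi\in\mathcal P_n^{k+1}$ with $\mathcal O(\pi)=\mathcal O$. For $b\in B_j$ let $\mathrm{rinv}(b,\pi)=\sum_{i>j}\#\{a\in B_i: a<b\}$, and let $\mathrm{rinv}(\mathcal F,\pi)=\sum_{b\in\mathcal F(\pi)}\mathrm{rinv}(b,\pi)$. Let $\mathrm{nrinv}(b,\pi)=\#\{a\in[n]: w_a>w_b,\ a>b\}$. Let $g(B_i)$ be the largest element of $B_i$. For $i\in[k+1]$ define $\mathrm{stat}_i(\pi)=k-\mathrm{rinv}(\mathcal F,\pi)-\mathrm{nrinv}(g(B_i),\pi)$. -}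

module Defs where

open import Data.Nat using (ℕ; zero; suc; _+_)
open import Data.Fin using (Fin; zero; suc; toℕ; inject₁; _<_)
open import Data.Fin.Properties using (_≟_; _<?_)
open import Data.Fin.Subset using (Subset; _∈_)
open import Data.List using (List; []; _∷_; length; filter; map; foldr)
open import Data.Nat.ListAction using (sum)
open import Data.List.Base using (allFin)
open import Data.Maybe using (Maybe; just; nothing)
open import Data.Product using (Σ; ∃; _×_; _,_)
open import Data.Integer using (ℤ; +_; _-_)
open import Relation.Nullary using (¬_; yes; no)
open import Relation.Nullary.Decidable using (¬?)
open import Relation.Binary using (Setoid)
open import Relation.Binary.PropositionalEquality using (_≡_; _≢_)
import Relation.Binary.PropositionalEquality as P
open import Function.Bundles using (_⇔_)

-- Conventions: the ground set [n] is Fin n (element a : Fin n stands for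
-- toℕ a + 1; the order is preserved). A set partition of [n] into m blocks
-- B_1 - ... - B_m (blocks listed by increasing smallest element) is encoded
-- by its block-index word w : Fin n → Fin m, w a = index of the block
-- containing a (block j : Fin m stands for B_{toℕ j + 1}).

record IsOrderedPartition {n m : ℕ} (w : Fin n → Fin m) : Set where
  field
    nonempty : ∀ (j : Fin m) → ∃ λ a → w a ≡ j
    -- if i < j then min B_i < min B_j : every element of B_j has a
    -- smaller element lying in B_i
    ordered  : ∀ (i j : Fin m) → i < j → ∀ b → w b ≡ j → ∃ λ a → a < b × w a ≡ i

IsOpener : {n m : ℕ} → (Fin n → Fin m) → Fin n → Set
IsOpener w a = ∀ b → b < a → w b ≢ w a

record Partition (n m : ℕ) : Set where
  constructor mkPartition
  field
    word      : Fin n → Fin m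
    isPartition : IsOrderedPartition word
open Partition public

record PartitionO (n m : ℕ) (O : Subset n) : Set where
  constructor mkPartitionO
  field
    part    : Partition n m
    openers : ∀ a → (a ∈ O) ⇔ IsOpener (word part) a
open PartitionO public

PartitionO-setoid : (n m : ℕ) (O : Subset n) → Setoid _ _
PartitionO-setoid n m O = record
  { Carrier = PartitionO n m O
  ; _≈_ = λ π σ → ∀ a → word (part π) a ≡ word (part σ) a
  ; isEquivalence = record
    { refl = λ a → P.refl
    ; sym = λ p a → P.sym (p a)
    ; trans = λ p q a → P.trans (p a) (q a)
    }
  }

count : (n : ℕ) → (P : Fin n → Set) → (∀ a → Relation.Nullary.Dec (P a)) → ℕ
count n P P? = length (filter P? (allFin n))

module _ {n m : ℕ} (w : Fin n → Fin m) where

  rinv : Fin n → ℕ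
  rinv b = count n (λ a → (w b < w a) × (a < b))
    (λ a → Relation.Nullary.Decidable._×-dec_ (w b <? w a) (a <? b))

  nrinv : Fin n → ℕ
  nrinv b = count n (λ a → (w b < w a) × (b < a))
    (λ a → Relation.Nullary.Decidable._×-dec_ (w b <? w a) (b <? a))

  IsCloser : Fin n → Set
  IsCloser b = ∀ c → b < c → w c ≢ w b

  isCloser? : ∀ b → Relation.Nullary.Dec (IsCloser b)
  isCloser? b = Data.Fin.Properties.all? λ c →
    Relation.Nullary.Decidable._→-dec_ (b <? c) (¬? (w c ≟ w b))

  rinvF : ℕ
  rinvF = sum (map rinv (filter isCloser? (allFin n)))

  -- g(B_i) : the largest element of block i (nothing only if B_i is
  -- empty, which never happens for a partition)
  g : Fin m → Maybe (Fin n)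
  g i = foldr (λ a r → step a r) nothing (allFin n)
    where
    step : Fin n → Maybe (Fin n) → Maybe (Fin n)
    step a (just b) = just b
    step a nothing with w a ≟ i
    ... | yes _ = just a
    ... | no _  = nothing

  nrinvMaybe : Maybe (Fin n) → ℕ
  nrinvMaybe (just b) = nrinv b
  nrinvMaybe nothing  = 0

stat : {n k : ℕ} → Fin (suc k) → Partition n (suc k) → ℤ
stat {n} {k} i π =
  (+ k) - (+ rinvF (word π)) - (+ nrinvMaybe (word π) (g (word π) i))

-- Write lo, hi for the adjacent blocks i, i + 1 and p for the last element of block hi. The
-- bijection φ swaps lo and hi on every element of these two blocks that lies after the opener
-- of block hi and not before p; its inverse does the same with the last element of block lo in
-- place of p. A swap of this kind only writes labels that already occur earlier in the word, so
-- openers and the order of the blocks survive it.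
-- Since rinv b + nrinv b counts the elements in blocks above that of b, the closers of the
-- other blocks and the elements above block hi contribute equally to rinv(F) + nrinv(g(B_lo))
-- for π and to rinv(F) + nrinv(g(B_hi)) for φ π. What is left is one more than the number of
-- elements before p lying above block lo in π, and the same count before the last element of
-- block lo in φ π; these two counts agree.
module Submission where

open import Defs
open import Data.Nat using (ℕ; suc; _≤_)
open import Data.Fin using (Fin; zero; suc; inject₁)
open import Data.Fin.Subset using (Subset; _∈_; ∣_∣)
open import Data.Integer using (_-_; +_)
open import Relation.Binary.PropositionalEquality using (_≡_)
open import Function.Bundles using (Bijection)
open import Data.Product using (Σ)

open import Data.Bool using (true; false; if_then_else_)
open import Data.Empty using (⊥-elim)
open import Data.Fin using (toℕ; _<_)
import Data.Fin as Fin
open import Data.Fin.Properties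
  using (_≟_; _<?_; any?; all?; <-trans; <-cmp; <-asym; <-irrefl; <⇒≢; toℕ-injective; toℕ-inject₁; ≤̄⇒inject₁<)
import Data.Integer as ℤ
import Data.Integer.Tactic.RingSolver as ℤ-Solver
open import Data.List using (List; []; _∷_; length; filter; map; foldr; tabulate; allFin)
open import Data.Maybe using (Maybe; just; nothing)
open import Data.Nat using (zero; _+_; z≤n; s≤s)
import Data.Nat.ListAction as List
import Data.Nat.Properties as ℕ
open import Data.Nat.Tactic.RingSolver using (solve-∀)
open import Algebra.Properties.CommutativeMonoid.Sum ℕ.+-0-commutativeMonoid
  using (sum; sum-cong-≗; ∑-distrib-+; sum-replicate-zero)
open import Data.Product using (∃; _×_; _,_; proj₁; proj₂)
import Data.Product as Product
open import Data.Sum using (_⊎_; inj₁; inj₂; [_,_])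
import Data.Sum as Sum
open import Function using (_∘_)
open import Function.Bundles using (Inverse; mk⇔)
open import Function.Construct.Composition using (_⇔-∘_)
open import Function.Properties.Inverse using (Inverse⇒Bijection)
open import Level using (Level; 0ℓ)
open import Relation.Binary.Definitions using (tri<; tri≈; tri>)
open import Relation.Binary.PropositionalEquality
  using (_≢_; _≗_; refl; sym; trans; cong; cong₂; subst; subst₂; module ≡-Reasoning)
open import Relation.Nullary using (¬_; Dec; yes; no; does)
open import Relation.Nullary.Decidable using (_×-dec_; _⊎-dec_; _→-dec_; ¬?; dec-true; dec-false)
open import Relation.Unary using (Pred; Decidable; _≐_; _⊥_; Empty)
open import Relation.Unary.Properties using (_∪?_; _∩?_; ∁?)

open ≡-Reasoning

sumWhere : ∀ {n p} {P : Pred (Fin n) p} → Decidable P → (Fin n → ℕ) → ℕ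
sumWhere P? f = sum λ a → if does (P? a) then f a else 0

# : ∀ {n p} {P : Pred (Fin n) p} → Decidable P → ℕ
# P? = sumWhere P? λ _ → 1

module _ {n : ℕ} {p q : Level} {P : Pred (Fin n) p} {Q : Pred (Fin n) q} (P? : Decidable P) (Q? : Decidable Q) where

  sumWhere-cong : ∀ {f g} → P ≐ Q → (∀ {a} → P a → f a ≡ g a) → sumWhere P? f ≡ sumWhere Q? g
  sumWhere-cong {f} {g} (P⊆Q , Q⊆P) f≡g = sum-cong-≗ pointwise
    where
    pointwise : ∀ a → (if does (P? a) then f a else 0) ≡ (if does (Q? a) then g a else 0)
    pointwise a with P? a | Q? a
    ... | yes pa | yes _  = f≡g pa
    ... | no  _  | no  _  = refl
    ... | yes pa | no ¬qa = ⊥-elim (¬qa (P⊆Q pa))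
    ... | no ¬pa | yes qa = ⊥-elim (¬pa (Q⊆P qa))

  sumWhere-∪ : ∀ f → P ⊥ Q → sumWhere (P? ∪? Q?) f ≡ sumWhere P? f + sumWhere Q? f
  sumWhere-∪ f disjoint = trans (sum-cong-≗ pointwise) (∑-distrib-+ {n} _ _)
    where
    pointwise : ∀ a → (if does ((P? ∪? Q?) a) then f a else 0)
                    ≡ (if does (P? a) then f a else 0) + (if does (Q? a) then f a else 0)
    pointwise a with P? a | Q? a
    ... | yes pa | yes qa = ⊥-elim (disjoint (pa , qa))
    ... | yes _  | no  _  = sym (ℕ.+-identityʳ (f a))
    ... | no  _  | yes _  = refl
    ... | no  _  | no  _  = refl

  #-cong : P ≐ Q → # P? ≡ # Q?
  #-cong P≐Q = sumWhere-cong P≐Q λ _ → refl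

  #-∪ : P ⊥ Q → # (P? ∪? Q?) ≡ # P? + # Q?
  #-∪ = sumWhere-∪ λ _ → 1

sumWhere-∅ : ∀ {n p} {P : Pred (Fin n) p} (P? : Decidable P) f → Empty P → sumWhere P? f ≡ 0
sumWhere-∅ {n} P? f empty = trans (sum-cong-≗ pointwise) (sum-replicate-zero n)
  where
  pointwise : ∀ a → (if does (P? a) then f a else 0) ≡ 0
  pointwise a with P? a
  ... | yes pa = ⊥-elim (empty a pa)
  ... | no  _  = refl

sumWhere-≟ : ∀ {n} (b : Fin n) f → sumWhere (_≟ b) f ≡ f b
sumWhere-≟ zero    f = trans (cong (_+_ (f zero)) (sumWhere-∅ (λ a → suc a ≟ zero) (f ∘ suc) λ _ ()))
                              (ℕ.+-identityʳ (f zero))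
sumWhere-≟ (suc b) f = sumWhere-≟ b (f ∘ suc)

sum-map-filter-tabulate : ∀ {n p} {A : Set} {P : Pred A p} (P? : Decidable P) (f : A → ℕ) (g : Fin n → A) →
  List.sum (map f (filter P? (tabulate g))) ≡ sum λ a → if does (P? (g a)) then f (g a) else 0
sum-map-filter-tabulate {zero}  P? f g = refl
sum-map-filter-tabulate {suc n} P? f g with does (P? (g zero))
... | true  = cong (_+_ (f (g zero))) (sum-map-filter-tabulate P? f (g ∘ suc))
... | false = sum-map-filter-tabulate P? f (g ∘ suc)

sum-map-filter : ∀ {n p} {P : Pred (Fin n) p} (P? : Decidable P) (f : Fin n → ℕ) →
  List.sum (map f (filter P? (allFin n))) ≡ sumWhere P? f
sum-map-filter P? f = sum-map-filter-tabulate P? f (λ a → a)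

count≡# : ∀ {n} (P : Pred (Fin n) 0ℓ) (P? : Decidable P) → count n P P? ≡ # P?
count≡# {n} P P? = trans (length≡sum-map-1 (filter P? (allFin n))) (sum-map-filter P? λ _ → 1)
  where
  length≡sum-map-1 : ∀ (xs : List (Fin n)) → length xs ≡ List.sum (map (λ _ → 1) xs)
  length≡sum-map-1 []       = refl
  length≡sum-map-1 (_ ∷ xs) = cong suc (length≡sum-map-1 xs)

least : ∀ {n p} {P : Pred (Fin n) p} → Decidable P → ∀ {a} → P a →
        ∃ λ b → P b × (∀ {c} → c < b → ¬ P c)
least {suc n} P? {a} pa with P? zero
... | yes p0 = zero , p0 , λ ()
least {suc n} P? {zero}  pa | no ¬p0 = ⊥-elim (¬p0 pa)
least {suc n} {P = P} P? {suc a} pa | no ¬p0 with least (P? ∘ suc) pa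
... | b , pb , below-b = suc b , pb , below-suc-b
  where
  below-suc-b : ∀ {c} → c < suc b → ¬ P c
  below-suc-b {zero}  _         = ¬p0
  below-suc-b {suc c} (s≤s c<b) = below-b c<b

greatest : ∀ {n p} {P : Pred (Fin n) p} → Decidable P → ∀ {a} → P a →
           ∃ λ b → P b × (∀ {c} → b < c → ¬ P c)
greatest {suc n} {P = P} P? {a} pa with any? (P? ∘ suc)
... | yes (a′ , pa′) with greatest (P? ∘ suc) pa′
...   | b , pb , above-b = suc b , pb , above-suc-b
  where
  above-suc-b : ∀ {c} → suc b < c → ¬ P c
  above-suc-b {suc c} (s≤s b<c) = above-b b<c
greatest {suc n} {P = P} P? {zero}  pa | no none = zero , pa , above-zero
  where
  above-zero : ∀ {c} → zero {n} < c → ¬ P c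
  above-zero {suc c} _ pc = none (c , pc)
greatest {suc n} P? {suc a} pa | no none = ⊥-elim (none (a , pa))

if-does : ∀ {p a} {P : Set p} {A : Set a} (d : Dec P) {x y : A} →
          (P × (if does d then x else y) ≡ x) ⊎ (¬ P × (if does d then x else y) ≡ y)
if-does (yes p) = inj₁ (p , refl)
if-does (no ¬p) = inj₂ (¬p , refl)

ℤ-shift : ∀ k r s r′ s′ → r + s ≡ r′ + s′ + 1 → + k - + r - + s ≡ + k - + r′ - + s′ - + 1
ℤ-shift k r s r′ s′ e = begin
  + k - + r - + s          ≡⟨ sub-sub (+ k) (+ r) (+ s) ⟩
  + k - + (r + s)          ≡⟨ cong (λ t → + k - + t) e ⟩
  + k - + (r′ + s′ + 1)    ≡⟨ sub-sub-sub (+ k) (+ r′) (+ s′) (+ 1) ⟨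
  + k - + r′ - + s′ - + 1  ∎
  where
  sub-sub : ∀ a b c → a - b - c ≡ a - (b ℤ.+ c)
  sub-sub = ℤ-Solver.solve-∀
  sub-sub-sub : ∀ a b c d → a - b - c - d ≡ a - (b ℤ.+ c ℤ.+ d)
  sub-sub-sub = ℤ-Solver.solve-∀

Word : ℕ → ℕ → Set
Word n m = Fin n → Fin m

module _ {n m : ℕ} where

  OccursBefore : Word n m → Fin m → Fin n → Set
  OccursBefore w j a = ∃ λ b → b < a × w b ≡ j

  Ordered : Word n m → Set
  Ordered w = ∀ i j → i < j → ∀ b → w b ≡ j → OccursBefore w i b

  LastOf : Word n m → Fin m → Fin n → Set
  LastOf w j b = w b ≡ j × (∀ c → b < c → w c ≢ j)

  occursBefore? : ∀ w j a → Dec (OccursBefore w j a)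
  occursBefore? w j a = any? λ b → (b <? a) ×-dec (w b ≟ j)

  occursBefore-mono : ∀ {w j a c} → OccursBefore w j a → a < c → OccursBefore w j c
  occursBefore-mono (b , b<a , wb) a<c = b , <-trans b<a a<c , wb

  opener⇒¬occursBefore : ∀ {w a} → IsOpener w a → ¬ OccursBefore w (w a) a
  opener⇒¬occursBefore opener (b , b<a , wb) = opener b b<a wb

  ¬occursBefore⇒opener : ∀ {w a} → ¬ OccursBefore w (w a) a → IsOpener w a
  ¬occursBefore⇒opener ¬occ b b<a wb = ¬occ (b , b<a , wb)

  ordered⇒<opener : ∀ {w p a} → Ordered w → IsOpener w p → a < p → w a < w p
  ordered⇒<opener {w} {p} {a} ordered opener a<p with <-cmp (w a) (w p)
  ... | tri< wa<wp _ _ = wa<wp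
  ... | tri≈ _ wa≡wp _ = ⊥-elim (opener a a<p wa≡wp)
  ... | tri> _ _ wp<wa with ordered (w p) (w a) wp<wa a refl
  ...   | c , c<a , wc = ⊥-elim (opener c (<-trans c<a a<p) wc)

  lastOf-unique : ∀ {w j b c} → LastOf w j b → LastOf w j c → b ≡ c
  lastOf-unique {b = b} {c} (wb , none-after-b) (wc , none-after-c) with <-cmp b c
  ... | tri< b<c _ _ = ⊥-elim (none-after-b c b<c wc)
  ... | tri≈ _ b≡c _ = b≡c
  ... | tri> _ _ c<b = ⊥-elim (none-after-c b c<b wb)

  <-lastOf : ∀ {w j a b c} → a < c → w c ≡ j → LastOf w j b → a < b
  <-lastOf {b = b} {c} a<c wc (_ , none-after) with <-cmp c b
  ... | tri< c<b _ _  = <-trans a<c c<b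
  ... | tri≈ _ refl _ = a<c
  ... | tri> _ _ b<c  = ⊥-elim (none-after c b<c wc)

  lastOf-exists : ∀ {w j a} → w a ≡ j → ∃ (LastOf w j)
  lastOf-exists {w} {j} wa with greatest (λ x → w x ≟ j) wa
  ... | b , wb , above-b = b , wb , λ c b<c → above-b b<c

  lastOf-block : ∀ {w} → IsOrderedPartition w → ∀ j → ∃ (LastOf w j)
  lastOf-block w-partition j = lastOf-exists (proj₂ (IsOrderedPartition.nonempty w-partition j))

  lastOf⇒isCloser : ∀ {w j b} → LastOf w j b → IsCloser w b
  lastOf⇒isCloser (wb , none-after) c b<c wc = none-after c b<c (trans wc wb)

  isCloser⇒lastOf : ∀ {w j b} → IsCloser w b → w b ≡ j → LastOf w j b
  isCloser⇒lastOf closer wb = wb , λ c b<c wc → closer c b<c (trans wc (sym wb))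

module _ {n m : ℕ} (w : Word n m) (j : Fin m) where

  private
    -- g folds a step function local to its definition; unification hands it back to us.
    stepOf : Σ (Fin n → Maybe (Fin n) → Maybe (Fin n)) λ step → g w j ≡ foldr step nothing (allFin n)
    stepOf = _ , refl

    step : Fin n → Maybe (Fin n) → Maybe (Fin n)
    step = proj₁ stepOf

    step-hit : ∀ {a} → w a ≡ j → step a nothing ≡ just a
    step-hit {a} wa with w a ≟ j
    ... | yes _  = refl
    ... | no wa≢ = ⊥-elim (wa≢ wa)

    step-miss : ∀ {a} → w a ≢ j → step a nothing ≡ nothing
    step-miss {a} wa≢ with w a ≟ j
    ... | yes wa = ⊥-elim (wa≢ wa)
    ... | no _   = refl

    foldr-miss : ∀ {k} (f : Fin k → Fin n) → (∀ c → w (f c) ≢ j) → foldr step nothing (tabulate f) ≡ nothing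
    foldr-miss {zero}  f miss = refl
    foldr-miss {suc k} f miss =
      trans (cong (step (f zero)) (foldr-miss (f ∘ suc) (miss ∘ suc))) (step-miss (miss zero))

    foldr-last : ∀ {k} (f : Fin k → Fin n) b → w (f b) ≡ j → (∀ {c} → b < c → w (f c) ≢ j) →
                 foldr step nothing (tabulate f) ≡ just (f b)
    foldr-last {suc k} f zero    hit miss-after =
      trans (cong (step (f zero)) (foldr-miss (f ∘ suc) (λ _ → miss-after (s≤s z≤n)))) (step-hit hit)
    foldr-last {suc k} f (suc b) hit miss-after =
      cong (step (f zero)) (foldr-last (f ∘ suc) b hit (miss-after ∘ s≤s))

  g≡just : ∀ {b} → LastOf w j b → g w j ≡ just b
  g≡just {b} (wb , none-after) = trans (proj₂ stepOf) (foldr-last (λ a → a) b wb (none-after _))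

Relabels : ∀ {n m} → Word n m → Word n m → Set
Relabels w v = ∀ a → v a ≡ w a ⊎ (OccursBefore w (w a) a × OccursBefore w (v a) a)

module _ {n m : ℕ} {w v : Word n m} (relabels : Relabels w v) where

  relabels-opener : ∀ {a} → IsOpener w a → v a ≡ w a
  relabels-opener {a} opener with relabels a
  ... | inj₁ va≡wa     = va≡wa
  ... | inj₂ (occ , _) = ⊥-elim (opener⇒¬occursBefore opener occ)

  relabels-occursBefore : ∀ {j a} → OccursBefore w j a → OccursBefore v j a
  relabels-occursBefore {j} {a} (b , b<a , wb) with least (λ x → (x <? a) ×-dec (w x ≟ j)) (b<a , wb)
  ... | c , (c<a , wc) , below-c = c , c<a , trans (relabels-opener c-opener) wc
    where
    c-opener : IsOpener w c
    c-opener d d<c wd = below-c d<c (<-trans d<c c<a , trans wd wc)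

  relabels-occursBefore⁻ : ∀ {j a} → OccursBefore v j a → OccursBefore w j a
  relabels-occursBefore⁻ (b , b<a , vb) with relabels b
  ... | inj₁ vb≡wb     = b , b<a , trans (sym vb≡wb) vb
  ... | inj₂ (_ , occ) = occursBefore-mono (subst (λ j → OccursBefore w j b) vb occ) b<a

  relabels-isOpener : ∀ {a} → IsOpener w a → IsOpener v a
  relabels-isOpener {a} opener = ¬occursBefore⇒opener λ occ →
    opener⇒¬occursBefore opener
      (subst (λ j → OccursBefore w j a) (relabels-opener opener) (relabels-occursBefore⁻ occ))

  relabels-isOpener⁻ : ∀ {a} → IsOpener v a → IsOpener w a
  relabels-isOpener⁻ {a} opener with relabels a
  ... | inj₁ va≡wa     = ¬occursBefore⇒opener λ occ →
    opener⇒¬occursBefore opener (subst (λ j → OccursBefore v j a) (sym va≡wa) (relabels-occursBefore occ))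
  ... | inj₂ (_ , occ) = ⊥-elim (opener⇒¬occursBefore opener (relabels-occursBefore occ))

  relabels-ordered : Ordered w → Ordered v
  relabels-ordered ordered i j i<j b vb with relabels b
  ... | inj₁ vb≡wb                = relabels-occursBefore (ordered i j i<j b (trans (sym vb≡wb) vb))
  ... | inj₂ (_ , (c , c<b , wc)) = relabels-occursBefore (occursBefore-mono (ordered i j i<j c (trans wc vb)) c<b)

  relabels-nonempty : ∀ {j} → (∃ λ a → w a ≡ j) → ∃ λ a → v a ≡ j
  relabels-nonempty (a , wa) with relabels a
  ... | inj₁ va≡wa = a , trans va≡wa wa
  ... | inj₂ (occ , _) with relabels-occursBefore occ
  ...   | c , _ , vc = c , trans vc wa

  relabels-isOrderedPartition : IsOrderedPartition w → IsOrderedPartition v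
  relabels-isOrderedPartition w-partition = record
    { nonempty = relabels-nonempty ∘ IsOrderedPartition.nonempty w-partition
    ; ordered  = relabels-ordered (IsOrderedPartition.ordered w-partition)
    }

module _ {n m : ℕ} where

  above : Word n m → Fin m → ℕ
  above w j = # λ a → j <? w a

  aboveBefore : Word n m → Fin m → Fin n → ℕ
  aboveBefore w j x = # λ a → (j <? w a) ×-dec (a <? x)

  blockSize : Word n m → Fin m → ℕ
  blockSize w j = # λ a → w a ≟ j

  rinv≡aboveBefore : ∀ w b → rinv w b ≡ aboveBefore w (w b) b
  rinv≡aboveBefore w b = count≡# (λ a → w b < w a × a < b) (λ a → (w b <? w a) ×-dec (a <? b))

  rinv+nrinv≡above : ∀ w b → rinv w b + nrinv w b ≡ above w (w b)
  rinv+nrinv≡above w b = begin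
    rinv w b + nrinv w b
      ≡⟨ cong₂ _+_ (count≡# _ before) (count≡# _ after) ⟩
    # before + # after
      ≡⟨ #-∪ before after (λ ((_ , a<b) , (_ , b<a)) → <-asym a<b b<a) ⟨
    # (before ∪? after)
      ≡⟨ #-cong (before ∪? after) (λ a → w b <? w a) ([ proj₁ , proj₁ ] , before-or-after) ⟩
    above w (w b) ∎
    where
    before : Decidable λ a → w b < w a × a < b
    before a = (w b <? w a) ×-dec (a <? b)
    after : Decidable λ a → w b < w a × b < a
    after a = (w b <? w a) ×-dec (b <? a)
    before-or-after : ∀ {a} → w b < w a → (w b < w a × a < b) ⊎ (w b < w a × b < a)
    before-or-after {a} wb<wa with <-cmp a b
    ... | tri< a<b _ _  = inj₁ (wb<wa , a<b)
    ... | tri≈ _ refl _ = ⊥-elim (<-irrefl refl wb<wa)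
    ... | tri> _ _ b<a  = inj₂ (wb<wa , b<a)

module Adjacent {m : ℕ} (i : Fin m) where

  lo hi : Fin (suc m)
  lo = inject₁ i
  hi = suc i

  lo<hi : lo < hi
  lo<hi = ≤̄⇒inject₁< (ℕ.≤-refl {toℕ i})

  lo≢hi : lo ≢ hi
  lo≢hi = <⇒≢ lo<hi

  lo<⇒hi<⊎≡hi : ∀ {x} → lo < x → hi < x ⊎ x ≡ hi
  lo<⇒hi<⊎≡hi {x} lo<x with ℕ.m≤n⇒m<n∨m≡n (subst (λ k → suc k ≤ toℕ x) (toℕ-inject₁ i) lo<x)
  ... | inj₁ hi<x = inj₁ hi<x
  ... | inj₂ hi≡x = inj₂ (toℕ-injective (sym hi≡x))

  hi<⊎≡hi⇒lo< : ∀ {x} → hi < x ⊎ x ≡ hi → lo < x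
  hi<⊎≡hi⇒lo< (inj₁ hi<x) = <-trans lo<hi hi<x
  hi<⊎≡hi⇒lo< (inj₂ refl) = lo<hi

  <hi⇒<lo⊎≡lo : ∀ {x} → x < hi → x < lo ⊎ x ≡ lo
  <hi⇒<lo⊎≡lo {x} (s≤s x≤i) with ℕ.m≤n⇒m<n∨m≡n (subst (toℕ x ≤_) (sym (toℕ-inject₁ i)) x≤i)
  ... | inj₁ x<lo = inj₁ x<lo
  ... | inj₂ x≡lo = inj₂ (toℕ-injective x≡lo)

  lo<⇒≮hi : ∀ {x} → lo < x → ¬ x < hi
  lo<⇒≮hi lo<x x<hi with lo<⇒hi<⊎≡hi lo<x
  ... | inj₁ hi<x = <-asym hi<x x<hi
  ... | inj₂ refl = <-irrefl refl x<hi

  LoHi : Pred (Fin (suc m)) 0ℓ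
  LoHi x = x ≡ lo ⊎ x ≡ hi

  LoHi? : Decidable LoHi
  LoHi? x = (x ≟ lo) ⊎-dec (x ≟ hi)

  hi<⇒¬LoHi : ∀ {x} → hi < x → ¬ LoHi x
  hi<⇒¬LoHi hi<lo (inj₁ refl) = <-asym lo<hi hi<lo
  hi<⇒¬LoHi hi<hi (inj₂ refl) = <-irrefl refl hi<hi

  <-LoHi : ∀ {x y z} → ¬ LoHi x → LoHi y → LoHi z → x < y → x < z
  <-LoHi ¬x-LoHi (inj₁ refl) (inj₁ refl) x<y = x<y
  <-LoHi ¬x-LoHi (inj₂ refl) (inj₂ refl) x<y = x<y
  <-LoHi ¬x-LoHi (inj₁ refl) (inj₂ refl) x<y = <-trans x<y lo<hi
  <-LoHi ¬x-LoHi (inj₂ refl) (inj₁ refl) x<y with <hi⇒<lo⊎≡lo x<y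
  ... | inj₁ x<lo = x<lo
  ... | inj₂ x≡lo = ⊥-elim (¬x-LoHi (inj₁ x≡lo))

  -- Only ever applied to lo or hi; every other label is sent to lo.
  swap : Fin (suc m) → Fin (suc m)
  swap x = if does (x ≟ lo) then hi else lo

  swap-lo : swap lo ≡ hi
  swap-lo = cong (if_then hi else lo) (dec-true (lo ≟ lo) refl)

  swap-hi : swap hi ≡ lo
  swap-hi = cong (if_then hi else lo) (dec-false (hi ≟ lo) (lo≢hi ∘ sym))

  swap-LoHi : ∀ {x} → LoHi x → LoHi (swap x)
  swap-LoHi (inj₁ refl) = inj₂ swap-lo
  swap-LoHi (inj₂ refl) = inj₁ swap-hi

  swap-involutive : ∀ {x} → LoHi x → swap (swap x) ≡ x
  swap-involutive (inj₁ refl) = trans (cong swap swap-lo) swap-hi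
  swap-involutive (inj₂ refl) = trans (cong swap swap-hi) swap-lo

  swap-≢ : ∀ {x} → LoHi x → swap x ≢ x
  swap-≢ (inj₁ refl) e = lo≢hi (trans (sym e) swap-lo)
  swap-≢ (inj₂ refl) e = lo≢hi (trans (sym swap-hi) e)

  LoHi-≢⇒swap : ∀ {s x} → LoHi s → LoHi x → x ≢ s → x ≡ swap s
  LoHi-≢⇒swap (inj₁ refl) (inj₁ refl) x≢s = ⊥-elim (x≢s refl)
  LoHi-≢⇒swap (inj₁ refl) (inj₂ refl) _   = sym swap-lo
  LoHi-≢⇒swap (inj₂ refl) (inj₁ refl) _   = sym swap-hi
  LoHi-≢⇒swap (inj₂ refl) (inj₂ refl) x≢s = ⊥-elim (x≢s refl)

  module _ {n : ℕ} where

    Flips : Fin (suc m) → Word n (suc m) → Fin n → Set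
    Flips s w a = LoHi (w a) × OccursBefore w hi a × (∀ c → a < c → w c ≢ s)

    flips? : ∀ s w a → Dec (Flips s w a)
    flips? s w a = LoHi? (w a) ×-dec occursBefore? w hi a ×-dec all? λ c → (a <? c) →-dec ¬? (w c ≟ s)

    -- φ hi is the bijection of the theorem and φ lo its inverse.
    φ : Fin (suc m) → Word n (suc m) → Word n (suc m)
    φ s w a = if does (flips? s w a) then swap (w a) else w a

    data View (s : Fin (suc m)) (w : Word n (suc m)) (a : Fin n) : Set where
      flipped : Flips s w a → φ s w a ≡ swap (w a) → View s w a
      kept    : ¬ Flips s w a → φ s w a ≡ w a → View s w a

    view : ∀ s w a → View s w a
    view s w a with if-does (flips? s w a)
    ... | inj₁ (flips , φa)  = flipped flips φa
    ... | inj₂ (¬flips , φa) = kept ¬flips φa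

    φ-flipped : ∀ {s w a} → Flips s w a → φ s w a ≡ swap (w a)
    φ-flipped {s} {w} {a} flips with view s w a
    ... | flipped _ φa  = φa
    ... | kept ¬flips _ = ⊥-elim (¬flips flips)

    φ-kept : ∀ {s w a} → ¬ Flips s w a → φ s w a ≡ w a
    φ-kept {s} {w} {a} ¬flips with view s w a
    ... | flipped flips _ = ⊥-elim (¬flips flips)
    ... | kept _ φa       = φa

    φ-off-LoHi : ∀ {s w a} → ¬ LoHi (w a) → φ s w a ≡ w a
    φ-off-LoHi {s} {w} {a} ¬wa-LoHi = φ-kept {s} {w} {a} (¬wa-LoHi ∘ proj₁)

    φ-LoHi : ∀ {s w a} → LoHi (w a) → LoHi (φ s w a)
    φ-LoHi {s} {w} {a} wa-LoHi with view s w a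
    ... | flipped _ φa = subst LoHi (sym φa) (swap-LoHi wa-LoHi)
    ... | kept _ φa    = subst LoHi (sym φa) wa-LoHi

    φ-before : ∀ {s w a c} → a < c → w c ≡ s → φ s w a ≡ w a
    φ-before {s} {w} {a} {c} a<c wc = φ-kept {s} {w} {a} λ (_ , _ , s-after) → s-after c a<c wc

    flips-resp-≗ : ∀ {s w v a} → w ≗ v → Flips s w a → Flips s v a
    flips-resp-≗ {a = a} w≗v (wa-LoHi , (b , b<a , wb) , s-after) =
      subst LoHi (w≗v a) wa-LoHi , (b , b<a , trans (sym (w≗v b)) wb)
      , λ c a<c vc → s-after c a<c (trans (w≗v c) vc)

    φ-cong : ∀ s {w v} → w ≗ v → φ s w ≗ φ s v
    φ-cong s {w} {v} w≗v a with view s w a | view s v a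
    ... | flipped _ φwa   | flipped _ φva   = trans φwa (trans (cong swap (w≗v a)) (sym φva))
    ... | kept _ φwa      | kept _ φva      = trans φwa (trans (w≗v a) (sym φva))
    ... | flipped flips _ | kept ¬flips _   = ⊥-elim (¬flips (flips-resp-≗ w≗v flips))
    ... | kept ¬flips _   | flipped flips _ = ⊥-elim (¬flips (flips-resp-≗ (sym ∘ w≗v) flips))

    φ-relabels : ∀ {s w} → Ordered w → Relabels w (φ s w)
    φ-relabels {s} {w} ordered a with view s w a
    ... | kept _ φa = inj₁ φa
    ... | flipped (wa-LoHi , hi-before@(b , b<a , wb) , _) φa =
      inj₂ (LoHi-occurs wa-LoHi , subst (λ x → OccursBefore w x a) (sym φa) (LoHi-occurs (swap-LoHi wa-LoHi)))
      where
      LoHi-occurs : ∀ {x} → LoHi x → OccursBefore w x a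
      LoHi-occurs (inj₁ refl) = occursBefore-mono (ordered lo hi lo<hi b wb) b<a
      LoHi-occurs (inj₂ refl) = hi-before

    φ-≢swap-after-flip : ∀ {s w a c} → LoHi s → Flips s w a → a < c → φ s w c ≢ swap s
    φ-≢swap-after-flip {s} {w} {a} {c} s-LoHi (_ , hi-before , s-after) a<c φc≡ with view s w c
    ... | flipped (wc-LoHi , _ , _) φc = swap-≢ s-LoHi (begin
      swap s              ≡⟨ φc≡ ⟨
      φ s w c             ≡⟨ φc ⟩
      swap (w c)          ≡⟨ cong swap (LoHi-≢⇒swap s-LoHi wc-LoHi (s-after c a<c)) ⟩
      swap (swap s)       ≡⟨ swap-involutive s-LoHi ⟩
      s                   ∎)
    ... | kept ¬flips φc = ¬flips
      ( subst LoHi (trans (sym φc≡) φc) (swap-LoHi s-LoHi)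
      , occursBefore-mono hi-before a<c
      , λ d c<d → s-after d (<-trans a<c c<d) )

    φ-≡swap-after-kept : ∀ {s w a} → LoHi s → ¬ Flips s w a → LoHi (w a) → OccursBefore w hi a →
                         ∃ λ c → a < c × φ s w c ≡ swap s
    φ-≡swap-after-kept {s} {w} {a} s-LoHi ¬flips wa-LoHi hi-before with any? (λ c → (a <? c) ×-dec (w c ≟ s))
    ... | no no-s-after = ⊥-elim (¬flips (wa-LoHi , hi-before , λ c a<c wc → no-s-after (c , a<c , wc)))
    ... | yes (c , a<c , wc) with lastOf-exists wc
    ...   | c′ , c′-last@(wc′ , none-after) =
      c′ , a<c′ , trans (φ-flipped {s} {w} {c′} c′-flips) (cong swap wc′)
      where
      a<c′ = <-lastOf a<c wc c′-last
      c′-flips : Flips s w c′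
      c′-flips = subst LoHi (sym wc′) s-LoHi , occursBefore-mono hi-before a<c′ , none-after

    φ-inverse : ∀ {s t w} → LoHi s → swap s ≡ t → Ordered w → φ t (φ s w) ≗ w
    φ-inverse {s} {t} {w} s-LoHi refl ordered a with view s w a
    ... | flipped flips@(wa-LoHi , hi-before , _) φa =
      trans (φ-flipped {t} {φ s w} {a} flips-back) (trans (cong swap φa) (swap-involutive wa-LoHi))
      where
      flips-back : Flips t (φ s w) a
      flips-back = φ-LoHi {s} {w} {a} wa-LoHi
                 , relabels-occursBefore (φ-relabels ordered) hi-before
                 , λ c a<c → φ-≢swap-after-flip s-LoHi flips a<c
    ... | kept ¬flips φa = trans (φ-kept {t} {φ s w} {a} ¬flips-back) φa
      where
      ¬flips-back : ¬ Flips t (φ s w) a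
      ¬flips-back (φa-LoHi , hi-before , t-after)
        with φ-≡swap-after-kept s-LoHi ¬flips (subst LoHi φa φa-LoHi)
                                (relabels-occursBefore⁻ (φ-relabels ordered) hi-before)
      ... | c , a<c , φc = t-after c a<c φc

    above-lo : ∀ (w : Word n (suc m)) → above w lo ≡ above w hi + blockSize w hi
    above-lo w = begin
      above w lo                   ≡⟨ #-cong (λ a → lo <? w a) (hi<? ∪? ≡hi?) (lo<⇒hi<⊎≡hi , hi<⊎≡hi⇒lo<) ⟩
      # (hi<? ∪? ≡hi?)             ≡⟨ #-∪ hi<? ≡hi? (λ (hi<wa , wa≡hi) → <⇒≢ hi<wa (sym wa≡hi)) ⟩
      above w hi + blockSize w hi  ∎
      where
      hi<? : Decidable λ a → hi < w a
      hi<? a = hi <? w a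
      ≡hi? : Decidable λ a → w a ≡ hi
      ≡hi? a = w a ≟ hi

    aboveBefore-hi+blockSize : ∀ {w : Word n (suc m)} {p} → LastOf w hi p →
                               aboveBefore w hi p + blockSize w hi ≡ aboveBefore w lo p + 1
    aboveBefore-hi+blockSize {w} {p} (wp , none-after) = begin
      aboveBefore w hi p + blockSize w hi    ≡⟨ cong (_+_ (aboveBefore w hi p)) blockSize-split ⟩
      aboveBefore w hi p + (# hi-before + 1) ≡⟨ ℕ.+-assoc (aboveBefore w hi p) (# hi-before) 1 ⟨
      aboveBefore w hi p + # hi-before + 1   ≡⟨ cong (λ k → k + 1) merge ⟩
      aboveBefore w lo p + 1                 ∎
      where
      hi<-before : Decidable λ a → hi < w a × a < p
      hi<-before a = (hi <? w a) ×-dec (a <? p)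
      hi-before : Decidable λ a → w a ≡ hi × a < p
      hi-before a = (w a ≟ hi) ×-dec (a <? p)

      blockSize-split : blockSize w hi ≡ # hi-before + 1
      blockSize-split = begin
        blockSize w hi           ≡⟨ #-cong (λ a → w a ≟ hi) (hi-before ∪? (_≟ p)) (before-or-p , hi-or-p) ⟩
        # (hi-before ∪? (_≟ p))  ≡⟨ #-∪ hi-before (_≟ p) (λ ((_ , a<p) , a≡p) → <-irrefl a≡p a<p) ⟩
        # hi-before + # (_≟ p)   ≡⟨ cong (_+_ (# hi-before)) (sumWhere-≟ p (λ _ → 1)) ⟩
        # hi-before + 1          ∎
        where
        before-or-p : ∀ {a} → w a ≡ hi → (w a ≡ hi × a < p) ⊎ a ≡ p
        before-or-p {a} wa with <-cmp a p
        ... | tri< a<p _ _ = inj₁ (wa , a<p)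
        ... | tri≈ _ a≡p _ = inj₂ a≡p
        ... | tri> _ _ p<a = ⊥-elim (none-after a p<a wa)
        hi-or-p : ∀ {a} → (w a ≡ hi × a < p) ⊎ a ≡ p → w a ≡ hi
        hi-or-p (inj₁ (wa , _)) = wa
        hi-or-p (inj₂ refl)     = wp

      merge : aboveBefore w hi p + # hi-before ≡ aboveBefore w lo p
      merge = begin
        aboveBefore w hi p + # hi-before
          ≡⟨ #-∪ hi<-before hi-before (λ ((hi<wa , _) , (wa≡hi , _)) → <⇒≢ hi<wa (sym wa≡hi)) ⟨
        # (hi<-before ∪? hi-before)
          ≡⟨ #-cong (hi<-before ∪? hi-before) (λ a → (lo <? w a) ×-dec (a <? p)) (to-lo , from-lo) ⟩
        aboveBefore w lo p ∎
        where
        to-lo : ∀ {a} → (hi < w a × a < p) ⊎ (w a ≡ hi × a < p) → lo < w a × a < p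
        to-lo (inj₁ (hi<wa , a<p)) = hi<⊎≡hi⇒lo< (inj₁ hi<wa) , a<p
        to-lo (inj₂ (wa≡hi , a<p)) = hi<⊎≡hi⇒lo< (inj₂ wa≡hi) , a<p
        from-lo : ∀ {a} → lo < w a × a < p → (hi < w a × a < p) ⊎ (w a ≡ hi × a < p)
        from-lo (lo<wa , a<p) = Sum.map (_, a<p) (_, a<p) (lo<⇒hi<⊎≡hi lo<wa)

    otherClosers? : ∀ (w : Word n (suc m)) → Decidable λ b → IsCloser w b × ¬ LoHi (w b)
    otherClosers? w = isCloser? w ∩? ∁? (LoHi? ∘ w)

    rinvOtherClosers : Word n (suc m) → ℕ
    rinvOtherClosers w = sumWhere (otherClosers? w) (rinv w)

    rinvF-split : ∀ {w L H} → LastOf w lo L → LastOf w hi H →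
                  rinvF w ≡ rinvOtherClosers w + (rinv w L + rinv w H)
    rinvF-split {w} {L} {H} L-last@(wL , _) H-last@(wH , _) = begin
      rinvF w
        ≡⟨ sum-map-filter (isCloser? w) (rinv w) ⟩
      sumWhere (isCloser? w) (rinv w)
        ≡⟨ sumWhere-cong (isCloser? w) (otherClosers? w ∪? ≟L∪H) (split , merge) (λ _ → refl) ⟩
      sumWhere (otherClosers? w ∪? ≟L∪H) (rinv w)
        ≡⟨ sumWhere-∪ (otherClosers? w) ≟L∪H (rinv w) others∩L∪H ⟩
      rinvOtherClosers w + sumWhere ≟L∪H (rinv w)
        ≡⟨ cong (_+_ (rinvOtherClosers w)) L∪H-sum ⟩
      rinvOtherClosers w + (rinv w L + rinv w H) ∎
      where
      ≟L∪H : Decidable λ b → b ≡ L ⊎ b ≡ H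
      ≟L∪H = (_≟ L) ∪? (_≟ H)

      split : ∀ {b} → IsCloser w b → (IsCloser w b × ¬ LoHi (w b)) ⊎ (b ≡ L ⊎ b ≡ H)
      split {b} closer with LoHi? (w b)
      ... | no ¬wb-LoHi      = inj₁ (closer , ¬wb-LoHi)
      ... | yes (inj₁ wb≡lo) = inj₂ (inj₁ (lastOf-unique (isCloser⇒lastOf closer wb≡lo) L-last))
      ... | yes (inj₂ wb≡hi) = inj₂ (inj₂ (lastOf-unique (isCloser⇒lastOf closer wb≡hi) H-last))

      merge : ∀ {b} → (IsCloser w b × ¬ LoHi (w b)) ⊎ (b ≡ L ⊎ b ≡ H) → IsCloser w b
      merge (inj₁ (closer , _)) = closer
      merge (inj₂ (inj₁ refl))  = lastOf⇒isCloser L-last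
      merge (inj₂ (inj₂ refl))  = lastOf⇒isCloser H-last

      others∩L∪H : (λ b → IsCloser w b × ¬ LoHi (w b)) ⊥ (λ b → b ≡ L ⊎ b ≡ H)
      others∩L∪H ((_ , ¬wb-LoHi) , inj₁ refl) = ¬wb-LoHi (inj₁ wL)
      others∩L∪H ((_ , ¬wb-LoHi) , inj₂ refl) = ¬wb-LoHi (inj₂ wH)

      L∪H-sum : sumWhere ≟L∪H (rinv w) ≡ rinv w L + rinv w H
      L∪H-sum = trans (sumWhere-∪ (_≟ L) (_≟ H) (rinv w) L∩H)
                      (cong₂ _+_ (sumWhere-≟ L (rinv w)) (sumWhere-≟ H (rinv w)))
        where
        L∩H : (_≡ L) ⊥ (_≡ H)
        L∩H (refl , refl) = lo≢hi (trans (sym wL) wH)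

    module _ {w v : Word n (suc m)} (keep : ∀ {a} → ¬ LoHi (w a) → v a ≡ w a)
                                    (stay : ∀ {a} → LoHi (w a) → LoHi (v a)) where

      private
        LoHi-back : ∀ {a} → LoHi (v a) → LoHi (w a)
        LoHi-back {a} va-LoHi with LoHi? (w a)
        ... | yes wa-LoHi = wa-LoHi
        ... | no ¬wa-LoHi = subst LoHi (keep ¬wa-LoHi) va-LoHi

        <-off-LoHi : ∀ {a b} → ¬ LoHi (w b) → v b < v a → w b < w a
        <-off-LoHi {a} ¬wb-LoHi vb<va with LoHi? (w a)
        ... | yes wa-LoHi = <-LoHi ¬wb-LoHi (stay wa-LoHi) wa-LoHi (subst (_< v a) (keep ¬wb-LoHi) vb<va)
        ... | no ¬wa-LoHi = subst₂ _<_ (keep ¬wb-LoHi) (keep ¬wa-LoHi) vb<va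

        <-off-LoHi⁻ : ∀ {a b} → ¬ LoHi (w b) → w b < w a → v b < v a
        <-off-LoHi⁻ {a} ¬wb-LoHi wb<wa with LoHi? (w a)
        ... | yes wa-LoHi = subst (_< v a) (sym (keep ¬wb-LoHi)) (<-LoHi ¬wb-LoHi wa-LoHi (stay wa-LoHi) wb<wa)
        ... | no ¬wa-LoHi = subst₂ _<_ (sym (keep ¬wb-LoHi)) (sym (keep ¬wa-LoHi)) wb<wa

        rinv-off-LoHi : ∀ {b} → ¬ LoHi (w b) → rinv v b ≡ rinv w b
        rinv-off-LoHi {b} ¬wb-LoHi = begin
          rinv v b
            ≡⟨ rinv≡aboveBefore v b ⟩
          aboveBefore v (v b) b
            ≡⟨ #-cong (λ a → (v b <? v a) ×-dec (a <? b)) (λ a → (w b <? w a) ×-dec (a <? b))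
              (Product.map₁ (<-off-LoHi ¬wb-LoHi) , Product.map₁ (<-off-LoHi⁻ ¬wb-LoHi)) ⟩
          aboveBefore w (w b) b
            ≡⟨ rinv≡aboveBefore w b ⟨
          rinv w b ∎

        isCloser-off-LoHi : ∀ {b} → ¬ LoHi (w b) → IsCloser v b → IsCloser w b
        isCloser-off-LoHi ¬wb-LoHi v-closer c b<c wc≡wb =
          v-closer c b<c (trans (keep (¬wb-LoHi ∘ subst LoHi wc≡wb)) (trans wc≡wb (sym (keep ¬wb-LoHi))))

        isCloser-off-LoHi⁻ : ∀ {b} → ¬ LoHi (w b) → IsCloser w b → IsCloser v b
        isCloser-off-LoHi⁻ ¬wb-LoHi w-closer c b<c vc≡vb =
          w-closer c b<c (trans (sym (keep ¬wc-LoHi)) (trans vc≡vb (keep ¬wb-LoHi)))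
          where
          ¬wc-LoHi = ¬wb-LoHi ∘ subst LoHi (trans vc≡vb (keep ¬wb-LoHi)) ∘ stay

      rinvOtherClosers-≡ : rinvOtherClosers v ≡ rinvOtherClosers w
      rinvOtherClosers-≡ =
        sumWhere-cong (otherClosers? v) (otherClosers? w) (to , from)
                      λ (_ , ¬vb-LoHi) → rinv-off-LoHi (¬vb-LoHi ∘ stay)
        where
        to : ∀ {b} → IsCloser v b × ¬ LoHi (v b) → IsCloser w b × ¬ LoHi (w b)
        to (v-closer , ¬vb-LoHi) = isCloser-off-LoHi (¬vb-LoHi ∘ stay) v-closer , ¬vb-LoHi ∘ stay
        from : ∀ {b} → IsCloser w b × ¬ LoHi (w b) → IsCloser v b × ¬ LoHi (v b)
        from (w-closer , ¬wb-LoHi) = isCloser-off-LoHi⁻ ¬wb-LoHi w-closer , ¬wb-LoHi ∘ LoHi-back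

      above-hi-≡ : above v hi ≡ above w hi
      above-hi-≡ = #-cong (λ a → hi <? v a) (λ a → hi <? w a) (to , from)
        where
        to : ∀ {a} → hi < v a → hi < w a
        to hi<va = subst (hi <_) (keep (hi<⇒¬LoHi hi<va ∘ stay)) hi<va
        from : ∀ {a} → hi < w a → hi < v a
        from hi<wa = subst (hi <_) (sym (keep (hi<⇒¬LoHi hi<wa))) hi<wa

    rinvF+nrinv-lastLo : ∀ {w L H} → LastOf w lo L → LastOf w hi H →
      rinvF w + nrinv w L ≡ rinvOtherClosers w + (aboveBefore w hi H + blockSize w hi) + above w hi
    rinvF+nrinv-lastLo {w} {L} {H} L-last@(wL , _) H-last@(wH , _) = begin
      rinvF w + nrinv w L
        ≡⟨ cong (λ k → k + nrinv w L) (rinvF-split L-last H-last) ⟩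
      rinvOtherClosers w + (rinv w L + rinv w H) + nrinv w L
        ≡⟨ regroup (rinvOtherClosers w) (rinv w L) (rinv w H) (nrinv w L) ⟩
      rinvOtherClosers w + rinv w H + (rinv w L + nrinv w L)
        ≡⟨ cong₂ (λ x y → rinvOtherClosers w + x + y) rinv-H rinv+nrinv-L ⟩
      rinvOtherClosers w + aboveBefore w hi H + (above w hi + blockSize w hi)
        ≡⟨ regroup′ (rinvOtherClosers w) (aboveBefore w hi H) (above w hi) (blockSize w hi) ⟩
      rinvOtherClosers w + (aboveBefore w hi H + blockSize w hi) + above w hi ∎
      where
      rinv-H : rinv w H ≡ aboveBefore w hi H
      rinv-H = trans (rinv≡aboveBefore w H) (cong (λ j → aboveBefore w j H) wH)
      rinv+nrinv-L : rinv w L + nrinv w L ≡ above w hi + blockSize w hi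
      rinv+nrinv-L = trans (rinv+nrinv≡above w L) (trans (cong (above w) wL) (above-lo w))
      regroup : ∀ o x y z → o + (x + y) + z ≡ o + y + (x + z)
      regroup = solve-∀
      regroup′ : ∀ o x y z → o + x + (y + z) ≡ o + (x + z) + y
      regroup′ = solve-∀

    rinvF+nrinv-lastHi : ∀ {w L H} → LastOf w lo L → LastOf w hi H →
      rinvF w + nrinv w H ≡ rinvOtherClosers w + aboveBefore w lo L + above w hi
    rinvF+nrinv-lastHi {w} {L} {H} L-last@(wL , _) H-last@(wH , _) = begin
      rinvF w + nrinv w H
        ≡⟨ cong (λ k → k + nrinv w H) (rinvF-split L-last H-last) ⟩
      rinvOtherClosers w + (rinv w L + rinv w H) + nrinv w H
        ≡⟨ regroup (rinvOtherClosers w) (rinv w L) (rinv w H) (nrinv w H) ⟩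
      rinvOtherClosers w + rinv w L + (rinv w H + nrinv w H)
        ≡⟨ cong₂ (λ x y → rinvOtherClosers w + x + y) rinv-L rinv+nrinv-H ⟩
      rinvOtherClosers w + aboveBefore w lo L + above w hi ∎
      where
      rinv-L : rinv w L ≡ aboveBefore w lo L
      rinv-L = trans (rinv≡aboveBefore w L) (cong (λ j → aboveBefore w j L) wL)
      rinv+nrinv-H : rinv w H + nrinv w H ≡ above w hi
      rinv+nrinv-H = trans (rinv+nrinv≡above w H) (cong (above w) wH)
      regroup : ∀ o x y z → o + (x + y) + z ≡ o + x + (y + z)
      regroup = solve-∀

    φ-after-lastHi : ∀ {w p c} → LastOf w hi p → p < c → φ hi w c ≢ lo
    φ-after-lastHi {w} {p} {c} (wp , none-after) p<c with view hi w c
    ... | flipped (inj₁ wc≡lo , _) φc = λ φc≡lo →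
      lo≢hi (trans (sym φc≡lo) (trans φc (trans (cong swap wc≡lo) swap-lo)))
    ... | flipped (inj₂ wc≡hi , _) _  = ⊥-elim (none-after c p<c wc≡hi)
    ... | kept ¬flips φc = λ φc≡lo →
      ¬flips (inj₁ (trans (sym φc) φc≡lo) , (p , p<c , wp) , λ d c<d → none-after d (<-trans p<c c<d))

    aboveBefore-lo≡0 : ∀ {u : Word n (suc m)} {p x} → Ordered u → IsOpener u p → u p ≡ hi → x Fin.≤ p →
                       aboveBefore u lo x ≡ 0
    aboveBefore-lo≡0 {u} {x = x} ordered opener up x≤p =
      sumWhere-∅ (λ a → (lo <? u a) ×-dec (a <? x)) (λ _ → 1) λ a (lo<ua , a<x) →
        lo<⇒≮hi lo<ua (subst (u a <_) up (ordered⇒<opener ordered opener (ℕ.<-≤-trans a<x x≤p)))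

    -- Either p is not the opener of its block, and then φ moves p to block lo without touching
    -- anything before it, so q = p; or p is that opener, and then both counts vanish.
    aboveBefore-φ : ∀ {w p q} → Ordered w → LastOf w hi p → LastOf (φ hi w) lo q →
                    aboveBefore w lo p ≡ aboveBefore (φ hi w) lo q
    aboveBefore-φ {w} {p} {q} ordered p-last@(wp , none-after) q-last@(φq , _) with occursBefore? w hi p
    ... | yes hi-before = begin
      aboveBefore w lo p
        ≡⟨ #-cong (λ a → (lo <? w a) ×-dec (a <? p)) (λ a → (lo <? φ hi w a) ×-dec (a <? p)) (to , from) ⟩
      aboveBefore (φ hi w) lo p
        ≡⟨ cong (aboveBefore (φ hi w) lo) (lastOf-unique p-last′ q-last) ⟩
      aboveBefore (φ hi w) lo q ∎
      where
      p-last′ : LastOf (φ hi w) lo p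
      p-last′ = trans (φ-flipped {hi} {w} {p} (inj₂ wp , hi-before , none-after)) (trans (cong swap wp) swap-hi)
              , λ c p<c → φ-after-lastHi p-last p<c
      to : ∀ {a} → lo < w a × a < p → lo < φ hi w a × a < p
      to (lo<wa , a<p) = subst (lo <_) (sym (φ-before a<p wp)) lo<wa , a<p
      from : ∀ {a} → lo < φ hi w a × a < p → lo < w a × a < p
      from (lo<φa , a<p) = subst (lo <_) (φ-before a<p wp) lo<φa , a<p
    ... | no ¬hi-before =
      trans (aboveBefore-lo≡0 ordered p-opener wp (ℕ.≤-refl {toℕ p}))
            (sym (aboveBefore-lo≡0 (relabels-ordered relabels ordered) (relabels-isOpener relabels p-opener)
                                   φp (ℕ.<⇒≤ q<p)))
      where
      relabels = φ-relabels {hi} ordered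
      p-opener : IsOpener w p
      p-opener = ¬occursBefore⇒opener (¬hi-before ∘ subst (λ j → OccursBefore w j p) wp)
      φp : φ hi w p ≡ hi
      φp = trans (relabels-opener relabels p-opener) wp
      q<p : q < p
      q<p with <-cmp q p
      ... | tri< q<p _ _  = q<p
      ... | tri≈ _ refl _ = ⊥-elim (lo≢hi (trans (sym φq) φp))
      ... | tri> _ _ p<q  = ⊥-elim (φ-after-lastHi p-last p<q φq)

    rinvF+nrinv-φ : ∀ {w L p q P} → Ordered w → LastOf w lo L → LastOf w hi p →
                    LastOf (φ hi w) lo q → LastOf (φ hi w) hi P →
                    rinvF w + nrinv w L ≡ rinvF (φ hi w) + nrinv (φ hi w) P + 1
    rinvF+nrinv-φ {w} {L} {p} {q} {P} ordered L-last p-last q-last P-last = begin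
      rinvF w + nrinv w L
        ≡⟨ rinvF+nrinv-lastLo L-last p-last ⟩
      rinvOtherClosers w + (aboveBefore w hi p + blockSize w hi) + above w hi
        ≡⟨ cong (λ k → rinvOtherClosers w + k + above w hi) key ⟩
      rinvOtherClosers w + (aboveBefore v lo q + 1) + above w hi
        ≡⟨ cong₂ (λ o a → o + (aboveBefore v lo q + 1) + a)
          (rinvOtherClosers-≡ keep stay) (above-hi-≡ keep stay) ⟨
      rinvOtherClosers v + (aboveBefore v lo q + 1) + above v hi
        ≡⟨ regroup (rinvOtherClosers v) (aboveBefore v lo q) (above v hi) ⟩
      rinvOtherClosers v + aboveBefore v lo q + above v hi + 1
        ≡⟨ cong (λ k → k + 1) (rinvF+nrinv-lastHi q-last P-last) ⟨
      rinvF v + nrinv v P + 1 ∎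
      where
      v = φ hi w
      keep : ∀ {a} → ¬ LoHi (w a) → v a ≡ w a
      keep {a} = φ-off-LoHi {hi} {w} {a}
      stay : ∀ {a} → LoHi (w a) → LoHi (v a)
      stay {a} = φ-LoHi {hi} {w} {a}
      key : aboveBefore w hi p + blockSize w hi ≡ aboveBefore v lo q + 1
      key = trans (aboveBefore-hi+blockSize p-last) (cong (λ k → k + 1) (aboveBefore-φ ordered p-last q-last))
      regroup : ∀ o x a → o + (x + 1) + a ≡ o + x + a + 1
      regroup = solve-∀

    φ-isOrderedPartition : ∀ {s w} → IsOrderedPartition w → IsOrderedPartition (φ s w)
    φ-isOrderedPartition w-partition =
      relabels-isOrderedPartition (φ-relabels (IsOrderedPartition.ordered w-partition)) w-partition

    φᴾ : Fin (suc m) → Partition n (suc m) → Partition n (suc m)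
    φᴾ s π = mkPartition (φ s (word π)) (φ-isOrderedPartition (isPartition π))

    stat-φ : ∀ (π : Partition n (suc m)) → stat lo π ≡ stat hi (φᴾ hi π) - + 1
    stat-φ π = begin
      stat lo π
        ≡⟨ cong (λ b → + m - + rinvF w - + nrinvMaybe w b) (g≡just w lo L-last) ⟩
      + m - + rinvF w - + nrinv w L
        ≡⟨ ℤ-shift m (rinvF w) (nrinv w L) (rinvF v) (nrinv v P)
          (rinvF+nrinv-φ (IsOrderedPartition.ordered (isPartition π)) L-last p-last q-last P-last) ⟩
      + m - + rinvF v - + nrinv v P - + 1
        ≡⟨ cong (λ b → + m - + rinvF v - + nrinvMaybe v b - + 1) (g≡just v hi P-last) ⟨
      stat hi (φᴾ hi π) - + 1 ∎
      where
      w = word π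
      v = φ hi w
      L = proj₁ (lastOf-block (isPartition π) lo)
      P = proj₁ (lastOf-block (isPartition (φᴾ hi π)) hi)
      L-last = proj₂ (lastOf-block (isPartition π) lo)
      p-last = proj₂ (lastOf-block (isPartition π) hi)
      q-last = proj₂ (lastOf-block (isPartition (φᴾ hi π)) lo)
      P-last = proj₂ (lastOf-block (isPartition (φᴾ hi π)) hi)

    φᴼ : ∀ {O} → Fin (suc m) → PartitionO n (suc m) O → PartitionO n (suc m) O
    φᴼ s π = mkPartitionO (φᴾ s (part π)) λ a →
      mk⇔ (relabels-isOpener relabels) (relabels-isOpener⁻ relabels) ⇔-∘ openers π a
      where
      relabels = φ-relabels {s} (IsOrderedPartition.ordered (isPartition (part π)))

    φᴼ-inverse : ∀ O → Inverse (PartitionO-setoid n (suc m) O) (PartitionO-setoid n (suc m) O)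
    φᴼ-inverse O = record
      { to        = φᴼ hi
      ; from      = φᴼ lo
      ; to-cong   = φ-cong hi
      ; from-cong = φ-cong lo
      ; inverse   = (λ {π} σ≈ a → trans (φ-cong hi σ≈ a) (φ-inverse (inj₁ refl) swap-lo (ordered π) a))
                  , (λ {π} σ≈ a → trans (φ-cong lo σ≈ a) (φ-inverse (inj₂ refl) swap-hi (ordered π) a))
      }
      where
      ordered : ∀ π → Ordered (word (part π))
      ordered π = IsOrderedPartition.ordered (isPartition (part π))

mainTheorem6 : (n k : ℕ) → 1 ≤ n → 1 ≤ k →
    (O : Subset n) → ∣ O ∣ ≡ suc k → (one : Fin n) → Data.Fin.toℕ one ≡ 0 → one ∈ O →
    (i : Fin k) →
    Σ (Bijection (PartitionO-setoid n (suc k) O) (PartitionO-setoid n (suc k) O)) λ φ →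
      ∀ (π : PartitionO n (suc k) O) →
        stat (inject₁ i) (part π)
          ≡ stat (suc i) (part (Bijection.to φ π)) - (+ 1)
mainTheorem6 n k _ _ O _ _ _ _ i = Inverse⇒Bijection (φᴼ-inverse O) , λ π → stat-φ (part π)
  where open Adjacent i
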